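{- For every even $n\ge 2$, \[\sum_{\sigma\in D_n} sign(\sigma)\,q^{\text{flag-major}_N(\sigma)}=\sum_{\sigma\in B_n} sign(\sigma)\,q^{\text{flag-major}_N(\sigma)}.\]
   Context: $B_n$ is the group of bijections $\sigma$ of $[-n,n]\setminus\{0\}$ with $\sigma(-a)=-\sigma(a)$, written $\sigma=[\sigma(1),\dots,\sigma(n)]$; $neg(\sigma)=|\{i:\sigma(i)<0\}|$ and $D_n=\{\sigma\in B_n: neg(\sigma)\text{ even}\}$. $N$ is the natural order $-n<\dots<-1<1<\dots<n$; $maj_N(\sigma)=\sum\{i\in[1,n-1]:\sigma(i)>\sigma(i+1)\}$; $\text{flag-major}_N(\sigma)=2maj_N(\sigma)+neg(\sigma)$. $\ell(\sigma)$ is the Coxeter length in $B_n$ w.r.t. $s_0=[-1,2,\dots,n]$ and the adjacent transpositions; equivalently $\ell(\sigma)=|\{i<j:\sigma(i)>\sigma(j)\}|-\sum_{i:\sigma(i)<0}\sigma(i)$; $sign(\sigma)=(-1)^{\ell(\sigma)}$. -}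

module Defs where

open import Data.Bool using (Bool; true; false; _∧_; not; if_then_else_)
open import Data.Nat as ℕ using (ℕ; zero; suc)
open import Data.Integer as ℤ using (ℤ; +_; -_; ∣_∣; _≤ᵇ_)
open import Data.List using (List; []; _∷_; map; concatMap; filterᵇ; foldr; length; upTo; allFin)
open import Data.Nat.Base using (_≡ᵇ_)

infix 4 _<ᵇ_
_<ᵇ_ : ℤ → ℤ → Bool
x <ᵇ y = not (y ≤ᵇ x)

-- A signed permutation σ ∈ B_n is represented by its window
-- [σ(1), …, σ(n)] as a list of nonzero integers.

alphabet : ℕ → List ℤ
alphabet n = map (λ i → - (+ suc i)) (upTo n) Data.List.++ map (λ i → + suc i) (upTo n)

words : List ℤ → ℕ → List (List ℤ)
words A zero    = [] ∷ []
words A (suc k) = concatMap (λ a → map (a ∷_) (words A k)) A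

elemᵇ : ℕ → List ℕ → Bool
elemᵇ x []       = false
elemᵇ x (y ∷ ys) = if x ≡ᵇ y then true else elemᵇ x ys

distinctᵇ : List ℕ → Bool
distinctᵇ []       = true
distinctᵇ (x ∷ xs) = not (elemᵇ x xs) ∧ distinctᵇ xs

-- a word of length n over [-n,n]\{0} is (the window of) an element of B_n
-- iff the absolute values σ(1),…,σ(n) are pairwise distinct, i.e. |σ| is a
-- permutation of [1,n]; σ is then extended to [-n,n]\{0} by σ(-a) = -σ(a).
isSignedPermᵇ : List ℤ → Bool
isSignedPermᵇ w = distinctᵇ (map ∣_∣ w)

Bn : ℕ → List (List ℤ)
Bn n = filterᵇ isSignedPermᵇ (words (alphabet n) n)

neg : List ℤ → ℕ
neg []       = zero
neg (x ∷ xs) = (if x <ᵇ + 0 then 1 else 0) ℕ.+ neg xs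

evenᵇ : ℕ → Bool
evenᵇ zero          = true
evenᵇ (suc zero)    = false
evenᵇ (suc (suc k)) = evenᵇ k

Dn : ℕ → List (List ℤ)
Dn n = filterᵇ (λ w → evenᵇ (neg w)) (Bn n)

-- maj_N with positions starting at index i (the window starts at position 1)
majFrom : ℕ → List ℤ → ℕ
majFrom i []           = zero
majFrom i (x ∷ [])     = zero
majFrom i (x ∷ y ∷ ys) = (if y <ᵇ x then i else 0) ℕ.+ majFrom (suc i) (y ∷ ys)

maj : List ℤ → ℕ
maj = majFrom 1

fmaj : List ℤ → ℕ
fmaj w = 2 ℕ.* maj w ℕ.+ neg w

countGreater : ℤ → List ℤ → ℕ
countGreater x []       = zero
countGreater x (y ∷ ys) = (if y <ᵇ x then 1 else 0) ℕ.+ countGreater x ys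

inv : List ℤ → ℕ
inv []       = zero
inv (x ∷ xs) = countGreater x xs ℕ.+ inv xs

negSum : List ℤ → ℕ
negSum []       = zero
negSum (x ∷ xs) = (if x <ᵇ + 0 then ∣ x ∣ else 0) ℕ.+ negSum xs

-- Coxeter length ℓ(σ) = inv(σ) - Σ_{σ(i)<0} σ(i)
len : List ℤ → ℕ
len w = inv w ℕ.+ negSum w

sign : List ℤ → ℤ
sign w = if evenᵇ (len w) then + 1 else - (+ 1)

sumℤ : List ℤ → ℤ
sumℤ = foldr ℤ._+_ (+ 0)

-- The polynomial Σ_{σ ∈ S} sign(σ) q^{fmaj(σ)} ∈ ℤ[q], given by its
-- coefficient sequence: coefficient of q^k.
signedFmajPoly : List (List ℤ) → ℕ → ℤ
signedFmajPoly S k = sumℤ (map sign (filterᵇ (λ w → fmaj w ≡ᵇ k) S))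

{-# OPTIONS --safe #-}
module Submission where

-- Group the values 1, …, n into blocks {2b+1, 2b+2}; this needs n even. If σ ∈ B_n ∖ D_n then
-- neg(σ) is odd, so some block holds an odd number of negative entries, i.e. its two values
-- occur with opposite signs. Exchanging the two values of the first such block (keeping the
-- signs) is an involution of B_n ∖ D_n. Since the exchanged letters have opposite signs, no
-- other letter lies between them in the order N, so every comparison, and with it inv, maj and
-- neg, is unchanged, whereas -Σ_{σ(i)<0} σ(i) changes by one. The involution therefore
-- preserves flag-major and reverses the sign, so the signed sum over B_n ∖ D_n vanishes.

open import Algebra.Properties.CommutativeSemigroup as CommSemigroup using ()
open import Data.Bool using (Bool; true; false; not; _∧_; T; if_then_else_)
open import Data.Empty using (⊥-elim)
open import Data.Integer as ℤ using (ℤ; +_; -[1+_]; ∣_∣)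
import Data.Integer.Properties as ℤP
open import Data.List
  using (List; []; _∷_; map; _++_; upTo; concatMap; cartesianProductWith; filterᵇ)
open import Data.List.Membership.Propositional using (_∈_)
open import Data.List.Membership.Propositional.Properties
  using ( ∈-map⁺; ∈-map⁻; ∈-filter⁺; ∈-filter⁻; ∈-++⁺ˡ; ∈-++⁺ʳ; ∈-++⁻; ∈-upTo⁺; ∈-upTo⁻
        ; ∈-cartesianProductWith⁺; ∈-cartesianProductWith⁻)
open import Data.List.Membership.Propositional.Properties.WithK using (unique∧set⇒bag)
open import Data.List.Properties using (map-∘; map-cong; map-cong-local; map-id; ∷-injective)
open import Data.List.Relation.Binary.BagAndSetEquality using (∼bag⇒↭)
open import Data.List.Relation.Binary.Disjoint.Propositional using (Disjoint)
open import Data.List.Relation.Binary.Permutation.Propositional using (_↭_; ↭⇒↭ₛ)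
import Data.List.Relation.Binary.Permutation.Propositional.Properties as ↭
open import Data.List.Relation.Binary.Permutation.Setoid.Properties using (foldr-commMonoid)
open import Data.List.Relation.Unary.All as All using (All; []; _∷_)
open import Data.List.Relation.Unary.AllPairs using ([]; _∷_)
open import Data.List.Relation.Unary.Any using (here; there)
open import Data.List.Relation.Unary.Unique.Propositional using (Unique)
import Data.List.Relation.Unary.Unique.Propositional.Properties as UniqueP
open import Data.Maybe using (Maybe; just; nothing; _<∣>_; maybe′)
open import Data.Nat as ℕ
  using (ℕ; zero; suc; _<_; _≤_; _≤ᵇ_; _≡ᵇ_; ⌊_/2⌋; _%_; parity; s≤s; z≤n)
import Data.Nat.Properties as ℕP
open import Data.Nat.Properties
  using (_≟_; suc-injective; <⇒<ᵇ; n<1+n; m<n⇒m<1+n; m<1+n⇒m<n∨m≡n)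
open import Data.Parity.Base using (Parity; 0ℙ; 1ℙ; _⁻¹) renaming (_+_ to _+ℙ_)
import Data.Parity.Properties as ℙP
open import Data.Parity.Properties using (+-homo-+; p+p≡0ℙ)
open import Data.Product using (_×_; _,_; proj₁; proj₂; ∃-syntax; ∃₂)
open import Data.Sum using (_⊎_; inj₁; inj₂)
open import Data.Unit using (tt)
open import Function.Base using (_∘_)
open import Function.Bundles using (mk⇔)
open import Function.Definitions using (Injective)
open import Relation.Binary.PropositionalEquality
open import Relation.Nullary.Decidable using (yes; no; T?; dec-true; dec-false)
open import Relation.Nullary.Negation using (¬_; contradiction)

open import Defs

open CommSemigroup ℕP.+-commutativeSemigroup using () renaming (interchange to ℕ-interchange)
open CommSemigroup ℙP.+-commutativeSemigroup using () renaming (interchange to ℙ-interchange)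
open CommSemigroup ℤP.+-commutativeSemigroup using () renaming (x∙yz≈y∙xz to ℤ-x∙yz≈y∙xz)

indicator : Bool → ℕ
indicator b = if b then 1 else 0

-- The transposition 2b ↔ 2b+1 of ℕ.
swapPair : ℕ → ℕ → ℕ
swapPair zero    zero          = 1
swapPair zero    (suc zero)    = 0
swapPair zero    (suc (suc k)) = suc (suc k)
swapPair (suc b) zero          = 0
swapPair (suc b) (suc zero)    = 1
swapPair (suc b) (suc (suc k)) = suc (suc (swapPair b k))

swapPair-involutive : ∀ b k → swapPair b (swapPair b k) ≡ k
swapPair-involutive zero    zero          = refl
swapPair-involutive zero    (suc zero)    = refl
swapPair-involutive zero    (suc (suc k)) = refl
swapPair-involutive (suc b) zero          = refl
swapPair-involutive (suc b) (suc zero)    = refl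
swapPair-involutive (suc b) (suc (suc k)) = cong (suc ∘ suc) (swapPair-involutive b k)

⌊swapPair/2⌋ : ∀ b k → ⌊ swapPair b k /2⌋ ≡ ⌊ k /2⌋
⌊swapPair/2⌋ zero    zero          = refl
⌊swapPair/2⌋ zero    (suc zero)    = refl
⌊swapPair/2⌋ zero    (suc (suc k)) = refl
⌊swapPair/2⌋ (suc b) zero          = refl
⌊swapPair/2⌋ (suc b) (suc zero)    = refl
⌊swapPair/2⌋ (suc b) (suc (suc k)) = cong suc (⌊swapPair/2⌋ b k)

swapPair-outside : ∀ b k → ⌊ k /2⌋ ≢ b → swapPair b k ≡ k
swapPair-outside zero    zero          k∉b = contradiction refl k∉b
swapPair-outside zero    (suc zero)    k∉b = contradiction refl k∉b
swapPair-outside zero    (suc (suc k)) _   = refl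
swapPair-outside (suc b) zero          _   = refl
swapPair-outside (suc b) (suc zero)    _   = refl
swapPair-outside (suc b) (suc (suc k)) k∉b = cong (suc ∘ suc) (swapPair-outside b k (k∉b ∘ cong suc))

swapPair-< : ∀ b k n → k < n → b < ⌊ n /2⌋ → swapPair b k < n
swapPair-< zero    zero          (suc (suc n)) _   _ = s≤s (s≤s z≤n)
swapPair-< zero    (suc zero)    (suc (suc n)) _   _ = s≤s z≤n
swapPair-< zero    (suc (suc k)) (suc (suc n)) k<n _ = k<n
swapPair-< (suc b) zero          (suc (suc n)) k<n _ = k<n
swapPair-< (suc b) (suc zero)    (suc (suc n)) k<n _ = k<n
swapPair-< (suc b) (suc (suc k)) (suc (suc n)) (s≤s (s≤s k<n)) (s≤s b<n/2) =
  s≤s (s≤s (swapPair-< b k n k<n b<n/2))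

parity-suc-swapPair : ∀ b k →
  parity (suc (swapPair b k)) ≡ parity (suc k) +ℙ parity (indicator (⌊ k /2⌋ ≡ᵇ b))
parity-suc-swapPair zero    zero          = refl
parity-suc-swapPair zero    (suc zero)    = refl
parity-suc-swapPair zero    (suc (suc k)) = sym (ℙP.+-identityʳ (parity (suc k)))
parity-suc-swapPair (suc b) zero          = refl
parity-suc-swapPair (suc b) (suc zero)    = refl
parity-suc-swapPair (suc b) (suc (suc k)) = parity-suc-swapPair b k

indicator-sameBlock : ∀ k j →
  indicator (⌊ j /2⌋ ≡ᵇ ⌊ k /2⌋) ≡ indicator (k ≡ᵇ j) ℕ.+ indicator (swapPair ⌊ k /2⌋ k ≡ᵇ j)
indicator-sameBlock zero          zero          = refl
indicator-sameBlock zero          (suc zero)    = refl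
indicator-sameBlock zero          (suc (suc j)) = refl
indicator-sameBlock (suc zero)    zero          = refl
indicator-sameBlock (suc zero)    (suc zero)    = refl
indicator-sameBlock (suc zero)    (suc (suc j)) = refl
indicator-sameBlock (suc (suc k)) zero          = refl
indicator-sameBlock (suc (suc k)) (suc zero)    = refl
indicator-sameBlock (suc (suc k)) (suc (suc j)) = indicator-sameBlock k j

indicator-<ᵇ-suc : ∀ a m → indicator (a ℕ.<ᵇ suc m) ≡ indicator (a ℕ.<ᵇ m) ℕ.+ indicator (a ≡ᵇ m)
indicator-<ᵇ-suc zero    zero    = refl
indicator-<ᵇ-suc zero    (suc m) = refl
indicator-<ᵇ-suc (suc a) zero    = refl
indicator-<ᵇ-suc (suc a) (suc m) = indicator-<ᵇ-suc a m

≤ᵇ-suc : ∀ a c → (suc a ≤ᵇ suc c) ≡ (a ≤ᵇ c)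
≤ᵇ-suc zero    c = refl
≤ᵇ-suc (suc a) c = refl

swapPair-≤ᵇ : ∀ b k l → (swapPair b k ≡ l → k ≡ l) → (swapPair b k ≤ᵇ swapPair b l) ≡ (k ≤ᵇ l)
swapPair-≤ᵇ zero    zero          zero          _ = refl
swapPair-≤ᵇ zero    zero          (suc zero)    h with () ← h refl
swapPair-≤ᵇ zero    zero          (suc (suc l)) _ = refl
swapPair-≤ᵇ zero    (suc zero)    zero          h with () ← h refl
swapPair-≤ᵇ zero    (suc zero)    (suc zero)    _ = refl
swapPair-≤ᵇ zero    (suc zero)    (suc (suc l)) _ = refl
swapPair-≤ᵇ zero    (suc (suc k)) zero          _ = refl
swapPair-≤ᵇ zero    (suc (suc k)) (suc zero)    _ = refl
swapPair-≤ᵇ zero    (suc (suc k)) (suc (suc l)) _ = refl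
swapPair-≤ᵇ (suc b) zero          l             _ = refl
swapPair-≤ᵇ (suc b) (suc zero)    zero          _ = refl
swapPair-≤ᵇ (suc b) (suc zero)    (suc zero)    _ = refl
swapPair-≤ᵇ (suc b) (suc zero)    (suc (suc l)) _ = refl
swapPair-≤ᵇ (suc b) (suc (suc k)) zero          _ = refl
swapPair-≤ᵇ (suc b) (suc (suc k)) (suc zero)    _ = refl
swapPair-≤ᵇ (suc b) (suc (suc k)) (suc (suc l)) h = begin
  (suc (suc (swapPair b k)) ≤ᵇ suc (suc (swapPair b l))) ≡⟨ ≤ᵇ-suc² (swapPair b k) (swapPair b l) ⟩
  (swapPair b k ≤ᵇ swapPair b l)                         ≡⟨ swapPair-≤ᵇ b k l h′ ⟩
  (k ≤ᵇ l)                                               ≡⟨ ≤ᵇ-suc² k l ⟨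
  (suc (suc k) ≤ᵇ suc (suc l))                           ∎
  where
  open ≡-Reasoning
  ≤ᵇ-suc² : ∀ a c → (suc (suc a) ≤ᵇ suc (suc c)) ≡ (a ≤ᵇ c)
  ≤ᵇ-suc² a c = trans (≤ᵇ-suc (suc a) (suc c)) (≤ᵇ-suc a c)
  h′ : swapPair b k ≡ l → k ≡ l
  h′ = suc-injective ∘ suc-injective ∘ h ∘ cong (suc ∘ suc)

-- The only place where the evenness of n is used: no value is alone in its block.
even-⌊/2⌋-< : ∀ {k} n → n % 2 ≡ 0 → k < n → ⌊ k /2⌋ < ⌊ n /2⌋
even-⌊/2⌋-< {zero}        (suc (suc n)) _    _                = s≤s z≤n
even-⌊/2⌋-< {suc zero}    (suc (suc n)) _    _                = s≤s z≤n
even-⌊/2⌋-< {suc (suc k)} (suc (suc n)) even (s≤s (s≤s k<n)) = s≤s (even-⌊/2⌋-< n even k<n)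

≡ᵇ-cong-injective : ∀ {f : ℕ → ℕ} → Injective _≡_ _≡_ f → ∀ a c → (f a ≡ᵇ f c) ≡ (a ≡ᵇ c)
≡ᵇ-cong-injective {f} inj a c with a ≟ c
... | yes a≡c = trans (dec-true (f a ≟ f c) (cong f a≡c)) (sym (dec-true (a ≟ c) a≡c))
... | no  a≢c = trans (dec-false (f a ≟ f c) (a≢c ∘ inj)) (sym (dec-false (a ≟ c) a≢c))

elemᵇ-map-injective : ∀ {f : ℕ → ℕ} → Injective _≡_ _≡_ f → ∀ a v → elemᵇ (f a) (map f v) ≡ elemᵇ a v
elemᵇ-map-injective inj a []      = refl
elemᵇ-map-injective inj a (c ∷ v) =
  cong₂ (λ t e → if t then true else e) (≡ᵇ-cong-injective inj a c) (elemᵇ-map-injective inj a v)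

distinctᵇ-map-injective : ∀ {f : ℕ → ℕ} → Injective _≡_ _≡_ f → ∀ v → distinctᵇ (map f v) ≡ distinctᵇ v
distinctᵇ-map-injective inj []      = refl
distinctᵇ-map-injective inj (a ∷ v) =
  cong₂ (λ e d → not e ∧ d) (elemᵇ-map-injective inj a v) (distinctᵇ-map-injective inj v)

elemᵇ-complete : ∀ {a as} → a ∈ as → T (elemᵇ a as)
elemᵇ-complete {a} (here refl) rewrite dec-true (a ≟ a) refl = tt
elemᵇ-complete {a} {b ∷ _} (there a∈) with a ≡ᵇ b
... | true  = tt
... | false = elemᵇ-complete a∈

distinctᵇ-∷ : ∀ a as → T (distinctᵇ (a ∷ as)) → ¬ T (elemᵇ a as) × T (distinctᵇ as)
distinctᵇ-∷ a as d with elemᵇ a as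
... | true  = ⊥-elim d
... | false = (λ ()) , d

swapAbs : ℕ → ℕ → ℕ
swapAbs b zero    = zero
swapAbs b (suc k) = suc (swapPair b k)

swapAbs-injective : ∀ b → Injective _≡_ _≡_ (swapAbs b)
swapAbs-injective b {zero}  {zero}  _ = refl
swapAbs-injective b {suc k} {suc l} e = cong suc (begin
  k                           ≡⟨ swapPair-involutive b k ⟨
  swapPair b (swapPair b k)   ≡⟨ cong (swapPair b) (suc-injective e) ⟩
  swapPair b (swapPair b l)   ≡⟨ swapPair-involutive b l ⟩
  l                           ∎)
  where open ≡-Reasoning

swapAbs-≤ᵇ : ∀ b k l → (swapAbs b k ≡ l → k ≡ l) → (swapAbs b k ≤ᵇ swapAbs b l) ≡ (k ≤ᵇ l)
swapAbs-≤ᵇ b zero    l       _ = refl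
swapAbs-≤ᵇ b (suc k) zero    _ = refl
swapAbs-≤ᵇ b (suc k) (suc l) h = begin
  (suc (swapPair b k) ≤ᵇ suc (swapPair b l)) ≡⟨ ≤ᵇ-suc (swapPair b k) (swapPair b l) ⟩
  (swapPair b k ≤ᵇ swapPair b l)             ≡⟨ swapPair-≤ᵇ b k l (suc-injective ∘ h ∘ cong suc) ⟩
  (k ≤ᵇ l)                                   ≡⟨ ≤ᵇ-suc k l ⟨
  (suc k ≤ᵇ suc l)                           ∎
  where open ≡-Reasoning

-- Exchanges the letters ±(2b+1) and ±(2b+2), keeping signs. The letter -[1+ k ] has absolute
-- value k + 1, so on negative letters the index k is moved by swapPair b.
swapBlock : ℕ → ℤ → ℤ
swapBlock b (+ k)    = + swapAbs b k
swapBlock b -[1+ k ] = -[1+ swapPair b k ]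

swapBlock-involutive : ∀ b x → swapBlock b (swapBlock b x) ≡ x
swapBlock-involutive b (+ zero)  = refl
swapBlock-involutive b (+ suc k) = cong (+_ ∘ suc) (swapPair-involutive b k)
swapBlock-involutive b -[1+ k ]  = cong -[1+_] (swapPair-involutive b k)

map-swapBlock-involutive : ∀ b w → map (swapBlock b) (map (swapBlock b) w) ≡ w
map-swapBlock-involutive b w =
  trans (sym (map-∘ w)) (trans (map-cong (swapBlock-involutive b) w) (map-id w))

∣swapBlock∣ : ∀ b x → ∣ swapBlock b x ∣ ≡ swapAbs b ∣ x ∣
∣swapBlock∣ b (+ k)    = refl
∣swapBlock∣ b -[1+ k ] = refl

swapBlock-sym : ∀ b {x y} → (swapBlock b x ≡ y → x ≡ y) → swapBlock b y ≡ x → y ≡ x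
swapBlock-sym b {x} {y} h e = sym (h (trans (cong (swapBlock b) (sym e)) (swapBlock-involutive b y)))

swapBlock-≤ᵇ : ∀ b x y → (swapBlock b x ≡ y → x ≡ y) →
  (swapBlock b x ℤ.≤ᵇ swapBlock b y) ≡ (x ℤ.≤ᵇ y)
swapBlock-≤ᵇ b (+ k)    (+ l)    h = swapAbs-≤ᵇ b k l (ℤP.+-injective ∘ h ∘ cong +_)
swapBlock-≤ᵇ b (+ k)    -[1+ l ] _ = refl
swapBlock-≤ᵇ b -[1+ k ] (+ l)    _ = refl
swapBlock-≤ᵇ b -[1+ k ] -[1+ l ] h =
  swapPair-≤ᵇ b l k (ℤP.-[1+-injective ∘ swapBlock-sym b h ∘ cong -[1+_])

swapBlock-<ᵇ : ∀ b x y → (swapBlock b x ≡ y → x ≡ y) → (swapBlock b y <ᵇ swapBlock b x) ≡ (y <ᵇ x)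
swapBlock-<ᵇ b x y h = cong not (swapBlock-≤ᵇ b x y h)

NoSwappedPair : ℕ → List ℤ → Set
NoSwappedPair b w = ∀ {x y} → x ∈ w → y ∈ w → swapBlock b x ≡ y → x ≡ y

countGreater-swapBlock : ∀ b x ys → (∀ {y} → y ∈ ys → swapBlock b x ≡ y → x ≡ y) →
  countGreater (swapBlock b x) (map (swapBlock b) ys) ≡ countGreater x ys
countGreater-swapBlock b x []       _ = refl
countGreater-swapBlock b x (y ∷ ys) h =
  cong₂ (λ c r → indicator c ℕ.+ r) (swapBlock-<ᵇ b x y (h (here refl)))
    (countGreater-swapBlock b x ys (h ∘ there))

inv-swapBlock : ∀ b w → NoSwappedPair b w → inv (map (swapBlock b) w) ≡ inv w
inv-swapBlock b []      _     = refl
inv-swapBlock b (x ∷ w) noSwp =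
  cong₂ ℕ._+_ (countGreater-swapBlock b x w (noSwp (here refl) ∘ there))
    (inv-swapBlock b w (λ x∈ y∈ → noSwp (there x∈) (there y∈)))

majFrom-swapBlock : ∀ b i w → NoSwappedPair b w → majFrom i (map (swapBlock b) w) ≡ majFrom i w
majFrom-swapBlock b i []          _     = refl
majFrom-swapBlock b i (x ∷ [])    _     = refl
majFrom-swapBlock b i (x ∷ y ∷ w) noSwp =
  cong₂ (λ c r → (if c then i else 0) ℕ.+ r)
    (swapBlock-<ᵇ b x y (noSwp (here refl) (there (here refl))))
    (majFrom-swapBlock b (suc i) (y ∷ w) (λ x∈ y∈ → noSwp (there x∈) (there y∈)))

neg-swapBlock : ∀ b w → neg (map (swapBlock b) w) ≡ neg w
neg-swapBlock b []             = refl
neg-swapBlock b (+ _ ∷ w)      = neg-swapBlock b w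
neg-swapBlock b (-[1+ _ ] ∷ w) = cong suc (neg-swapBlock b w)

fmaj-swapBlock : ∀ b w → NoSwappedPair b w → fmaj (map (swapBlock b) w) ≡ fmaj w
fmaj-swapBlock b w noSwp =
  cong₂ (λ m n → 2 ℕ.* m ℕ.+ n) (majFrom-swapBlock b 1 w noSwp) (neg-swapBlock b w)

isSignedPerm-swapBlock : ∀ b w → isSignedPermᵇ (map (swapBlock b) w) ≡ isSignedPermᵇ w
isSignedPerm-swapBlock b w = begin
  distinctᵇ (map ∣_∣ (map (swapBlock b) w)) ≡⟨ cong distinctᵇ (map-∘ w) ⟨
  distinctᵇ (map (∣_∣ ∘ swapBlock b) w)     ≡⟨ cong distinctᵇ (map-cong (∣swapBlock∣ b) w) ⟩
  distinctᵇ (map (swapAbs b ∘ ∣_∣) w)       ≡⟨ cong distinctᵇ (map-∘ w) ⟩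
  distinctᵇ (map (swapAbs b) (map ∣_∣ w))   ≡⟨ distinctᵇ-map-injective (swapAbs-injective b) (map ∣_∣ w) ⟩
  distinctᵇ (map ∣_∣ w)                     ∎
  where open ≡-Reasoning

-- Negative letters are selected by their index k, i.e. by absolute value k + 1.
negativesWith : (ℕ → Bool) → List ℤ → ℕ
negativesWith p []             = 0
negativesWith p (+ _ ∷ w)      = negativesWith p w
negativesWith p (-[1+ k ] ∷ w) = indicator (p k) ℕ.+ negativesWith p w

negativesInBlock : ℕ → List ℤ → ℕ
negativesInBlock b = negativesWith (λ k → ⌊ k /2⌋ ≡ᵇ b)

negativesBelow : ℕ → List ℤ → ℕ
negativesBelow m = negativesWith (λ k → ⌊ k /2⌋ ℕ.<ᵇ m)

occurrences : ℕ → List ℤ → ℕ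
occurrences k = negativesWith (k ≡ᵇ_)

negativesWith-+ : ∀ {p q r} → (∀ k → indicator (r k) ≡ indicator (p k) ℕ.+ indicator (q k)) →
  ∀ w → negativesWith r w ≡ negativesWith p w ℕ.+ negativesWith q w
negativesWith-+ split []             = refl
negativesWith-+ split (+ _ ∷ w)      = negativesWith-+ split w
negativesWith-+ {p} {q} split (-[1+ k ] ∷ w) = begin
  indicator _ ℕ.+ negativesWith _ w
    ≡⟨ cong₂ ℕ._+_ (split k) (negativesWith-+ split w) ⟩
  (indicator (p k) ℕ.+ indicator (q k)) ℕ.+ (negativesWith p w ℕ.+ negativesWith q w)
    ≡⟨ ℕ-interchange (indicator (p k)) (indicator (q k)) _ _ ⟩
  (indicator (p k) ℕ.+ negativesWith p w) ℕ.+ (indicator (q k) ℕ.+ negativesWith q w)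
    ∎
  where open ≡-Reasoning

negativesWith-false : ∀ {p} → (∀ k → p k ≡ false) → ∀ w → negativesWith p w ≡ 0
negativesWith-false never []             = refl
negativesWith-false never (+ _ ∷ w)      = negativesWith-false never w
negativesWith-false never (-[1+ k ] ∷ w) rewrite never k = negativesWith-false never w

negativesWith-swapBlock : ∀ {p} b → (∀ k → p (swapPair b k) ≡ p k) →
  ∀ w → negativesWith p (map (swapBlock b) w) ≡ negativesWith p w
negativesWith-swapBlock b inv []             = refl
negativesWith-swapBlock b inv (+ _ ∷ w)      = negativesWith-swapBlock b inv w
negativesWith-swapBlock b inv (-[1+ k ] ∷ w) =
  cong₂ ℕ._+_ (cong indicator (inv k)) (negativesWith-swapBlock b inv w)

neg-negativesWith : ∀ {p} w → (∀ {k} → -[1+ k ] ∈ w → T (p k)) → neg w ≡ negativesWith p w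
neg-negativesWith []             _   = refl
neg-negativesWith (+ _ ∷ w)      all = neg-negativesWith w (all ∘ there)
neg-negativesWith {p} (-[1+ k ] ∷ w) all with p k | all (here refl)
... | true | _ = cong suc (neg-negativesWith w (all ∘ there))

negativesInBlock-swapBlock : ∀ j b w → negativesInBlock j (map (swapBlock b) w) ≡ negativesInBlock j w
negativesInBlock-swapBlock j b = negativesWith-swapBlock b (λ k → cong (_≡ᵇ j) (⌊swapPair/2⌋ b k))

negativesInBlock-pair : ∀ k w →
  negativesInBlock ⌊ k /2⌋ w ≡ occurrences k w ℕ.+ occurrences (swapPair ⌊ k /2⌋ k) w
negativesInBlock-pair k = negativesWith-+ (indicator-sameBlock k)

negativesBelow-even : ∀ m w → (∀ {b} → b < m → parity (negativesInBlock b w) ≡ 0ℙ) →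
  parity (negativesBelow m w) ≡ 0ℙ
negativesBelow-even zero    w _    = cong parity (negativesWith-false (λ _ → refl) w)
negativesBelow-even (suc m) w even = begin
  parity (negativesBelow (suc m) w)
    ≡⟨ cong parity (negativesWith-+ (λ k → indicator-<ᵇ-suc ⌊ k /2⌋ m) w) ⟩
  parity (negativesBelow m w ℕ.+ negativesInBlock m w)
    ≡⟨ +-homo-+ (negativesBelow m w) _ ⟩
  parity (negativesBelow m w) +ℙ parity (negativesInBlock m w)
    ≡⟨ cong₂ _+ℙ_ (negativesBelow-even m w (even ∘ m<n⇒m<1+n)) (even (n<1+n m)) ⟩
  0ℙ
    ∎
  where open ≡-Reasoning

parity-negSum-swapBlock : ∀ b w →
  parity (negSum (map (swapBlock b) w)) ≡ parity (negSum w) +ℙ parity (negativesInBlock b w)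
parity-negSum-swapBlock b []             = refl
parity-negSum-swapBlock b (+ _ ∷ w)      = parity-negSum-swapBlock b w
parity-negSum-swapBlock b (-[1+ k ] ∷ w) = begin
  parity (suc (swapPair b k) ℕ.+ negSum (map (swapBlock b) w))
    ≡⟨ +-homo-+ (suc (swapPair b k)) _ ⟩
  parity (suc (swapPair b k)) +ℙ parity (negSum (map (swapBlock b) w))
    ≡⟨ cong₂ _+ℙ_ (parity-suc-swapPair b k) (parity-negSum-swapBlock b w) ⟩
  (parity (suc k) +ℙ parity inBlock) +ℙ (parity (negSum w) +ℙ parity (negativesInBlock b w))
    ≡⟨ ℙ-interchange (parity (suc k)) _ _ _ ⟩
  (parity (suc k) +ℙ parity (negSum w)) +ℙ (parity inBlock +ℙ parity (negativesInBlock b w))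
    ≡⟨ cong₂ _+ℙ_ (+-homo-+ (suc k) (negSum w)) (+-homo-+ inBlock _) ⟨
  parity (suc k ℕ.+ negSum w) +ℙ parity (negativesInBlock b (-[1+ k ] ∷ w))
    ∎
  where
  open ≡-Reasoning
  inBlock = indicator (⌊ k /2⌋ ≡ᵇ b)

occurrences-absent : ∀ {k} w → ¬ T (elemᵇ (suc k) (map ∣_∣ w)) → occurrences k w ≡ 0
occurrences-absent []                 _ = refl
occurrences-absent {k} (+ l ∷ w)      ∉ with suc k ≡ᵇ l
... | true  = contradiction tt ∉
... | false = occurrences-absent w ∉
occurrences-absent {k} (-[1+ l ] ∷ w) ∉ with k ≡ᵇ l
... | true  = contradiction tt ∉
... | false = occurrences-absent w ∉

occurrences-∷ : ∀ {k} z w → ∣ z ∣ ≢ suc k → occurrences k (z ∷ w) ≡ occurrences k w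
occurrences-∷ (+ l) w _ = refl
occurrences-∷ {k} -[1+ l ] w ∣z∣≢ with k ≟ l
... | yes refl = contradiction refl ∣z∣≢
... | no  k≢l  = cong (λ c → indicator c ℕ.+ occurrences k w) (dec-false (k ≟ l) k≢l)

occurrences-∈ : ∀ {k x} w → T (distinctᵇ (map ∣_∣ w)) → x ∈ w → ∣ x ∣ ≡ suc k →
  occurrences k w ≡ neg (x ∷ [])
occurrences-∈ {k} (+ _ ∷ w) d (here refl) refl =
  occurrences-absent w (proj₁ (distinctᵇ-∷ (suc k) (map ∣_∣ w) d))
occurrences-∈ {k} (-[1+ _ ] ∷ w) d (here refl) refl =
  cong₂ (λ c r → indicator c ℕ.+ r) (dec-true (k ≟ k) refl)
    (occurrences-absent w (proj₁ (distinctᵇ-∷ (suc k) (map ∣_∣ w) d)))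
occurrences-∈ {k} {x} (z ∷ w) d (there x∈) ∣x∣≡ = begin
  occurrences k (z ∷ w) ≡⟨ occurrences-∷ z w ∣z∣≢ ⟩
  occurrences k w       ≡⟨ occurrences-∈ w d′ x∈ ∣x∣≡ ⟩
  neg (x ∷ [])          ∎
  where
  open ≡-Reasoning
  z∉ = proj₁ (distinctᵇ-∷ ∣ z ∣ (map ∣_∣ w) d)
  d′ = proj₂ (distinctᵇ-∷ ∣ z ∣ (map ∣_∣ w) d)
  ∣z∣≢ : ∣ z ∣ ≢ suc k
  ∣z∣≢ ∣z∣≡ = z∉ (subst (λ a → T (elemᵇ a (map ∣_∣ w))) (trans ∣x∣≡ (sym ∣z∣≡))
                        (elemᵇ-complete (∈-map⁺ ∣_∣ x∈)))

sameSignPair⇒evenBlock : ∀ {k x y} w → T (isSignedPermᵇ w) → x ∈ w → y ∈ w →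
  ∣ x ∣ ≡ suc k → ∣ y ∣ ≡ suc (swapPair ⌊ k /2⌋ k) → neg (x ∷ []) ≡ neg (y ∷ []) →
  parity (negativesInBlock ⌊ k /2⌋ w) ≡ 0ℙ
sameSignPair⇒evenBlock {k} {x} w sp x∈ y∈ ∣x∣≡ ∣y∣≡ sameSign = begin
  parity (negativesInBlock ⌊ k /2⌋ w)
    ≡⟨ cong parity (negativesInBlock-pair k w) ⟩
  parity (occurrences k w ℕ.+ occurrences (swapPair ⌊ k /2⌋ k) w)
    ≡⟨ cong parity (cong₂ ℕ._+_ (occurrences-∈ w sp x∈ ∣x∣≡)
                                (trans (occurrences-∈ w sp y∈ ∣y∣≡) (sym sameSign))) ⟩
  parity (neg (x ∷ []) ℕ.+ neg (x ∷ []))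
    ≡⟨ +-homo-+ (neg (x ∷ [])) _ ⟩
  parity (neg (x ∷ [])) +ℙ parity (neg (x ∷ []))
    ≡⟨ p+p≡0ℙ (parity (neg (x ∷ []))) ⟩
  0ℙ
    ∎
  where open ≡-Reasoning

oddBlock⇒NoSwappedPair : ∀ {b} w → T (isSignedPermᵇ w) → parity (negativesInBlock b w) ≡ 1ℙ →
  NoSwappedPair b w
oddBlock⇒NoSwappedPair w sp odd {+ zero} _ _ refl = refl
oddBlock⇒NoSwappedPair {b} w sp odd {+ suc k} x∈ y∈ refl with ⌊ k /2⌋ ≟ b
... | no  k∉b  = cong (+_ ∘ suc) (sym (swapPair-outside b k k∉b))
... | yes refl = contradiction (trans (sym (sameSignPair⇒evenBlock w sp x∈ y∈ refl refl refl)) odd) λ ()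
oddBlock⇒NoSwappedPair {b} w sp odd { -[1+ k ]} x∈ y∈ refl with ⌊ k /2⌋ ≟ b
... | no  k∉b  = cong -[1+_] (sym (swapPair-outside b k k∉b))
... | yes refl = contradiction (trans (sym (sameSignPair⇒evenBlock w sp x∈ y∈ refl refl refl)) odd) λ ()

parity-len-swapBlock : ∀ b w → T (isSignedPermᵇ w) → parity (negativesInBlock b w) ≡ 1ℙ →
  parity (len (map (swapBlock b) w)) ≡ parity (len w) ⁻¹
parity-len-swapBlock b w sp odd = begin
  parity (inv (map (swapBlock b) w) ℕ.+ negSum (map (swapBlock b) w))
    ≡⟨ +-homo-+ (inv (map (swapBlock b) w)) _ ⟩
  parity (inv (map (swapBlock b) w)) +ℙ parity (negSum (map (swapBlock b) w))
    ≡⟨ cong₂ _+ℙ_ (cong parity (inv-swapBlock b w (oddBlock⇒NoSwappedPair w sp odd)))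
                  (parity-negSum-swapBlock b w) ⟩
  parity (inv w) +ℙ (parity (negSum w) +ℙ parity (negativesInBlock b w))
    ≡⟨ cong (λ p → parity (inv w) +ℙ (parity (negSum w) +ℙ p)) odd ⟩
  parity (inv w) +ℙ (parity (negSum w) +ℙ 1ℙ)
    ≡⟨ ℙP.+-assoc (parity (inv w)) _ _ ⟨
  (parity (inv w) +ℙ parity (negSum w)) +ℙ 1ℙ
    ≡⟨ cong (_+ℙ 1ℙ) (+-homo-+ (inv w) (negSum w)) ⟨
  parity (len w) +ℙ 1ℙ
    ≡⟨ ℙP.+-comm (parity (len w)) 1ℙ ⟩
  parity (len w) ⁻¹
    ∎
  where open ≡-Reasoning

evenᵇ-opposite : ∀ m n → parity m ≡ parity n ⁻¹ → evenᵇ m ≡ not (evenᵇ n)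
evenᵇ-opposite zero          zero          ()
evenᵇ-opposite zero          (suc zero)    _ = refl
evenᵇ-opposite (suc zero)    zero          _ = refl
evenᵇ-opposite (suc zero)    (suc zero)    ()
evenᵇ-opposite (suc (suc m)) n             e = evenᵇ-opposite m n e
evenᵇ-opposite zero          (suc (suc n)) e = evenᵇ-opposite zero n e
evenᵇ-opposite (suc zero)    (suc (suc n)) e = evenᵇ-opposite (suc zero) n e

not-evenᵇ⇒parity≡1ℙ : ∀ n → T (not (evenᵇ n)) → parity n ≡ 1ℙ
not-evenᵇ⇒parity≡1ℙ (suc zero)    _   = refl
not-evenᵇ⇒parity≡1ℙ (suc (suc n)) odd = not-evenᵇ⇒parity≡1ℙ n odd

sign-opposite : ∀ v w → parity (len v) ≡ parity (len w) ⁻¹ → sign v ≡ ℤ.- sign w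
sign-opposite v w e rewrite evenᵇ-opposite (len v) (len w) e with evenᵇ (len w)
... | true  = refl
... | false = refl

sign-swapBlock : ∀ b w → T (isSignedPermᵇ w) → parity (negativesInBlock b w) ≡ 1ℙ →
  sign (map (swapBlock b) w) ≡ ℤ.- sign w
sign-swapBlock b w sp odd = sign-opposite (map (swapBlock b) w) w (parity-len-swapBlock b w sp odd)

∈-alphabet⁻ : ∀ n {x} → x ∈ alphabet n → ∃[ k ] k < n × (x ≡ -[1+ k ] ⊎ x ≡ + suc k)
∈-alphabet⁻ n x∈ with ∈-++⁻ (map (λ i → ℤ.- (+ suc i)) (upTo n)) x∈
... | inj₁ x∈neg with ∈-map⁻ _ x∈neg
...   | k , k∈ , refl = k , ∈-upTo⁻ k∈ , inj₁ refl
∈-alphabet⁻ n x∈ | inj₂ x∈pos with ∈-map⁻ _ x∈pos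
...   | k , k∈ , refl = k , ∈-upTo⁻ k∈ , inj₂ refl

-[1+]∈alphabet⁻ : ∀ n {k} → -[1+ k ] ∈ alphabet n → k < n
-[1+]∈alphabet⁻ n k∈ with ∈-alphabet⁻ n k∈
... | _ , k<n , inj₁ refl = k<n

-[1+]∈alphabet : ∀ n {k} → k < n → -[1+ k ] ∈ alphabet n
-[1+]∈alphabet n k<n = ∈-++⁺ˡ (∈-map⁺ (λ i → ℤ.- (+ suc i)) (∈-upTo⁺ k<n))

+suc∈alphabet : ∀ n {k} → k < n → + suc k ∈ alphabet n
+suc∈alphabet n k<n =
  ∈-++⁺ʳ (map (λ i → ℤ.- (+ suc i)) (upTo n)) (∈-map⁺ (λ i → + suc i) (∈-upTo⁺ k<n))

swapBlock-∈-alphabet : ∀ {b n x} → b < ⌊ n /2⌋ → x ∈ alphabet n → swapBlock b x ∈ alphabet n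
swapBlock-∈-alphabet {b} {n} b<n/2 x∈ with ∈-alphabet⁻ n x∈
... | k , k<n , inj₁ refl = -[1+]∈alphabet n (swapPair-< b k n k<n b<n/2)
... | k , k<n , inj₂ refl = +suc∈alphabet n (swapPair-< b k n k<n b<n/2)

alphabet-unique : ∀ n → Unique (alphabet n)
alphabet-unique n =
  UniqueP.++⁺ (UniqueP.map⁺ ℤP.-[1+-injective (UniqueP.upTo⁺ n))
              (UniqueP.map⁺ (suc-injective ∘ ℤP.+-injective) (UniqueP.upTo⁺ n)) disjoint
  where
  disjoint : Disjoint (map (λ i → ℤ.- (+ suc i)) (upTo n)) (map (λ i → + suc i) (upTo n))
  disjoint (x∈neg , x∈pos) with ∈-map⁻ _ x∈neg | ∈-map⁻ _ x∈pos
  ... | _ , _ , refl | _ , _ , ()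

words-suc : ∀ A k → words A (suc k) ≡ cartesianProductWith _∷_ A (words A k)
words-suc A k = concatMap-prepend A
  where
  concatMap-prepend : ∀ B →
    concatMap (λ a → map (a ∷_) (words A k)) B ≡ cartesianProductWith _∷_ B (words A k)
  concatMap-prepend []      = refl
  concatMap-prepend (a ∷ B) = cong (map (a ∷_) (words A k) ++_) (concatMap-prepend B)

∈-words-suc⁻ : ∀ A k {w} → w ∈ words A (suc k) → ∃₂ λ a v → a ∈ A × v ∈ words A k × w ≡ a ∷ v
∈-words-suc⁻ A k w∈ = ∈-cartesianProductWith⁻ _∷_ A (words A k) (subst (_ ∈_) (words-suc A k) w∈)

∈-words-suc⁺ : ∀ A k {a v} → a ∈ A → v ∈ words A k → a ∷ v ∈ words A (suc k)
∈-words-suc⁺ A k a∈ v∈ = subst (_ ∈_) (sym (words-suc A k)) (∈-cartesianProductWith⁺ _∷_ a∈ v∈)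

∈-words⇒All : ∀ A k {w} → w ∈ words A k → All (_∈ A) w
∈-words⇒All A zero    (here refl) = []
∈-words⇒All A (suc k) w∈ with ∈-words-suc⁻ A k w∈
... | _ , _ , a∈ , v∈ , refl = a∈ ∷ ∈-words⇒All A k v∈

map-∈-words : ∀ {A g} → (∀ {a} → a ∈ A → g a ∈ A) → ∀ k {w} → w ∈ words A k → map g w ∈ words A k
map-∈-words g∈ zero    (here refl) = here refl
map-∈-words {A} g∈ (suc k) w∈ with ∈-words-suc⁻ A k w∈
... | _ , _ , a∈ , v∈ , refl = ∈-words-suc⁺ A k (g∈ a∈) (map-∈-words g∈ k v∈)

words-unique : ∀ {A} → Unique A → ∀ k → Unique (words A k)
words-unique uA zero        = [] ∷ []
words-unique {A} uA (suc k) = subst Unique (sym (words-suc A k))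
  (UniqueP.cartesianProductWith⁺ _∷_ ∷-injective uA (words-unique uA k))

justIfOdd : ℕ → Parity → Maybe ℕ
justIfOdd b 0ℙ = nothing
justIfOdd b 1ℙ = just b

firstOdd : (ℕ → ℕ) → ℕ → Maybe ℕ
firstOdd f zero    = nothing
firstOdd f (suc m) = firstOdd f m <∣> justIfOdd m (parity (f m))

firstOdd-cong : ∀ {f g} → (∀ b → f b ≡ g b) → ∀ m → firstOdd f m ≡ firstOdd g m
firstOdd-cong f≗g zero    = refl
firstOdd-cong f≗g (suc m) = cong₂ _<∣>_ (firstOdd-cong f≗g m) (cong (justIfOdd m ∘ parity) (f≗g m))

firstOdd-just : ∀ {f b} m → firstOdd f m ≡ just b → b < m × parity (f b) ≡ 1ℙ
firstOdd-just {f} (suc m) e with firstOdd f m in e₁ | parity (f m) in e₂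
firstOdd-just (suc m) refl | just _  | _  = let b<m , odd = firstOdd-just m e₁ in m<n⇒m<1+n b<m , odd
firstOdd-just (suc m) refl | nothing | 1ℙ = n<1+n m , e₂

firstOdd-nothing : ∀ {f b} m → firstOdd f m ≡ nothing → b < m → parity (f b) ≡ 0ℙ
firstOdd-nothing {f} (suc m) e b<1+m with firstOdd f m in e₁ | parity (f m) in e₂
firstOdd-nothing (suc m) refl b<1+m | nothing | 0ℙ with m<1+n⇒m<n∨m≡n b<1+m
... | inj₁ b<m  = firstOdd-nothing m e₁ b<m
... | inj₂ refl = e₂

oddBlock : ℕ → List ℤ → Maybe ℕ
oddBlock n w = firstOdd (λ b → negativesInBlock b w) ⌊ n /2⌋

swapOddBlock : ℕ → List ℤ → List ℤ
swapOddBlock n w = maybe′ (λ b → map (swapBlock b) w) w (oddBlock n w)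

data SwapOddBlockView (n : ℕ) (w : List ℤ) : List ℤ → Set where
  unchanged : oddBlock n w ≡ nothing → SwapOddBlockView n w w
  swapped   : ∀ {b} → oddBlock n w ≡ just b → SwapOddBlockView n w (map (swapBlock b) w)

swapOddBlock-view : ∀ n w → SwapOddBlockView n w (swapOddBlock n w)
swapOddBlock-view n w with oddBlock n w in e
... | nothing = unchanged e
... | just b  = swapped e

oddBlock-swapBlock : ∀ n b w → oddBlock n (map (swapBlock b) w) ≡ oddBlock n w
oddBlock-swapBlock n b w = firstOdd-cong (λ j → negativesInBlock-swapBlock j b w) ⌊ n /2⌋

swapOddBlock-involutive : ∀ n w → swapOddBlock n (swapOddBlock n w) ≡ w
swapOddBlock-involutive n w with swapOddBlock n w | swapOddBlock-view n w
... | _ | unchanged e   = cong (maybe′ _ w) e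
... | _ | swapped {b} e = begin
  swapOddBlock n (map (swapBlock b) w)    ≡⟨ cong (maybe′ _ _) (trans (oddBlock-swapBlock n b w) e) ⟩
  map (swapBlock b) (map (swapBlock b) w) ≡⟨ map-swapBlock-involutive b w ⟩
  w                                       ∎
  where open ≡-Reasoning

swapOddBlock-invariant : ∀ {A : Set} (f : List ℤ → A) → (∀ b w → f (map (swapBlock b) w) ≡ f w) →
  ∀ n w → f (swapOddBlock n w) ≡ f w
swapOddBlock-invariant f inv n w with swapOddBlock n w | swapOddBlock-view n w
... | _ | unchanged _   = refl
... | _ | swapped {b} _ = inv b w

fmaj-swapOddBlock : ∀ n w → T (isSignedPermᵇ w) → fmaj (swapOddBlock n w) ≡ fmaj w
fmaj-swapOddBlock n w sp with swapOddBlock n w | swapOddBlock-view n w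
... | _ | unchanged _   = refl
... | _ | swapped {b} e =
  fmaj-swapBlock b w (oddBlock⇒NoSwappedPair w sp (proj₂ (firstOdd-just ⌊ n /2⌋ e)))

swapOddBlock-∈-words : ∀ n k {w} → w ∈ words (alphabet n) k → swapOddBlock n w ∈ words (alphabet n) k
swapOddBlock-∈-words n k {w} w∈ with swapOddBlock n w | swapOddBlock-view n w
... | _ | unchanged _ = w∈
... | _ | swapped e   = map-∈-words (swapBlock-∈-alphabet (proj₁ (firstOdd-just ⌊ n /2⌋ e))) k w∈

noOddBlock⇒parity-neg≡0ℙ : ∀ n w → n % 2 ≡ 0 → All (_∈ alphabet n) w → oddBlock n w ≡ nothing →
  parity (neg w) ≡ 0ℙ
noOddBlock⇒parity-neg≡0ℙ n w even letters none = begin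
  parity (neg w)                    ≡⟨ cong parity (neg-negativesWith w inBlocksBelow) ⟩
  parity (negativesBelow ⌊ n /2⌋ w) ≡⟨ negativesBelow-even ⌊ n /2⌋ w (firstOdd-nothing ⌊ n /2⌋ none) ⟩
  0ℙ                                ∎
  where
  open ≡-Reasoning
  inBlocksBelow : ∀ {k} → -[1+ k ] ∈ w → T (⌊ k /2⌋ ℕ.<ᵇ ⌊ n /2⌋)
  inBlocksBelow k∈ = <⇒<ᵇ (even-⌊/2⌋-< n even (-[1+]∈alphabet⁻ n (All.lookup letters k∈)))

sign-swapOddBlock : ∀ n w → n % 2 ≡ 0 → All (_∈ alphabet n) w → T (isSignedPermᵇ w) →
  parity (neg w) ≡ 1ℙ → sign (swapOddBlock n w) ≡ ℤ.- sign w
sign-swapOddBlock n w even letters sp odd with swapOddBlock n w | swapOddBlock-view n w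
... | _ | unchanged e   =
  contradiction (trans (sym (noOddBlock⇒parity-neg≡0ℙ n w even letters e)) odd) λ ()
... | _ | swapped {b} e = sign-swapBlock b w sp (proj₂ (firstOdd-just ⌊ n /2⌋ e))

sumℤ-↭ : ∀ {xs ys} → xs ↭ ys → sumℤ xs ≡ sumℤ ys
sumℤ-↭ p = foldr-commMonoid (setoid ℤ) ℤP.+-0-isCommutativeMonoid (↭⇒↭ₛ p)

sumℤ-map-neg : ∀ {A : Set} (f : A → ℤ) xs → sumℤ (map (ℤ.-_ ∘ f) xs) ≡ ℤ.- sumℤ (map f xs)
sumℤ-map-neg f []       = refl
sumℤ-map-neg f (x ∷ xs) = trans (cong (λ s → ℤ.- f x ℤ.+ s) (sumℤ-map-neg f xs))
                                (sym (ℤP.neg-distrib-+ (f x) (sumℤ (map f xs))))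

self-negating⇒zero : ∀ {x} → x ≡ ℤ.- x → x ≡ + 0
self-negating⇒zero {+ zero} _ = refl

sumℤ-signReversingInvolution : ∀ {A : Set} (f : A → ℤ) (φ : A → A) {xs} → Unique xs →
  (∀ x → φ (φ x) ≡ x) → (∀ {x} → x ∈ xs → φ x ∈ xs) → (∀ {x} → x ∈ xs → f (φ x) ≡ ℤ.- f x) →
  sumℤ (map f xs) ≡ + 0
sumℤ-signReversingInvolution f φ {xs} unique involutive closed reverses = self-negating⇒zero (begin
  sumℤ (map f xs)          ≡⟨ sumℤ-↭ (↭.map⁺ f φxs↭xs) ⟨
  sumℤ (map f (map φ xs))  ≡⟨ cong sumℤ (map-∘ xs) ⟨
  sumℤ (map (f ∘ φ) xs)    ≡⟨ cong sumℤ (map-cong-local (All.tabulate reverses)) ⟩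
  sumℤ (map (ℤ.-_ ∘ f) xs) ≡⟨ sumℤ-map-neg f xs ⟩
  ℤ.- sumℤ (map f xs)      ∎)
  where
  open ≡-Reasoning
  φ-injective : ∀ {x y} → φ x ≡ φ y → x ≡ y
  φ-injective {x} {y} e = trans (sym (involutive x)) (trans (cong φ e) (involutive y))
  to : ∀ {x} → x ∈ map φ xs → x ∈ xs
  to x∈ with ∈-map⁻ φ x∈
  ... | _ , y∈ , refl = closed y∈
  from : ∀ {x} → x ∈ xs → x ∈ map φ xs
  from {x} x∈ = subst (_∈ map φ xs) (involutive x) (∈-map⁺ φ (closed x∈))
  φxs↭xs : map φ xs ↭ xs
  φxs↭xs = ∼bag⇒↭ (unique∧set⇒bag (UniqueP.map⁺ φ-injective unique) unique (mk⇔ to from))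

sumℤ-filterᵇ-partition : ∀ {A : Set} (f : A → ℤ) (q p : A → Bool) xs →
  sumℤ (map f (filterᵇ q xs))
    ≡ sumℤ (map f (filterᵇ q (filterᵇ p xs))) ℤ.+ sumℤ (map f (filterᵇ q (filterᵇ (not ∘ p) xs)))
sumℤ-filterᵇ-partition f q p []       = refl
sumℤ-filterᵇ-partition f q p (x ∷ xs) with p x
... | true  with q x
...   | true  = trans (cong (λ s → f x ℤ.+ s) (sumℤ-filterᵇ-partition f q p xs))
                      (sym (ℤP.+-assoc (f x) _ _))
...   | false = sumℤ-filterᵇ-partition f q p xs
sumℤ-filterᵇ-partition f q p (x ∷ xs) | false with q x
...   | true  = trans (cong (λ s → f x ℤ.+ s) (sumℤ-filterᵇ-partition f q p xs))
                      (ℤ-x∙yz≈y∙xz (f x) (sumℤ (map f (filterᵇ q (filterᵇ p xs))))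
                                          (sumℤ (map f (filterᵇ q (filterᵇ (not ∘ p) xs)))))
...   | false = sumℤ-filterᵇ-partition f q p xs

filterᵇ-closed : ∀ {A : Set} (p : A → Bool) {φ : A → A} {xs} → (∀ {x} → x ∈ xs → φ x ∈ xs) →
  (∀ {x} → x ∈ xs → p (φ x) ≡ p x) → ∀ {x} → x ∈ filterᵇ p xs → φ x ∈ filterᵇ p xs
filterᵇ-closed p closed invariant x∈ with ∈-filter⁻ (T? ∘ p) x∈
... | x∈xs , px = ∈-filter⁺ (T? ∘ p) (closed x∈xs) (subst T (sym (invariant x∈xs)) px)

Bn∖Dn : ℕ → List (List ℤ)
Bn∖Dn n = filterᵇ (not ∘ evenᵇ ∘ neg) (Bn n)

∈-Bn∖Dn⁻ : ∀ n {w} → w ∈ Bn∖Dn n →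
  w ∈ words (alphabet n) n × T (isSignedPermᵇ w) × parity (neg w) ≡ 1ℙ
∈-Bn∖Dn⁻ n {w} w∈ with ∈-filter⁻ (T? ∘ not ∘ evenᵇ ∘ neg) w∈
... | w∈Bn , odd with ∈-filter⁻ (T? ∘ isSignedPermᵇ) w∈Bn
...   | w∈words , sp = w∈words , sp , not-evenᵇ⇒parity≡1ℙ (neg w) odd

swapOddBlock-∈-Bn∖Dn : ∀ n {w} → w ∈ Bn∖Dn n → swapOddBlock n w ∈ Bn∖Dn n
swapOddBlock-∈-Bn∖Dn n =
  filterᵇ-closed (not ∘ evenᵇ ∘ neg)
    (filterᵇ-closed isSignedPermᵇ (swapOddBlock-∈-words n n)
      (λ {w} _ → swapOddBlock-invariant isSignedPermᵇ isSignedPerm-swapBlock n w))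
    (λ {w} _ → cong (not ∘ evenᵇ) (swapOddBlock-invariant neg neg-swapBlock n w))

signedFmajPoly-Bn∖Dn : ∀ n → n % 2 ≡ 0 → ∀ k → signedFmajPoly (Bn∖Dn n) k ≡ + 0
signedFmajPoly-Bn∖Dn n even k =
  sumℤ-signReversingInvolution sign (swapOddBlock n) unique (swapOddBlock-involutive n)
    closed reverses
  where
  fmaj≡k : List ℤ → Bool
  fmaj≡k w = fmaj w ≡ᵇ k
  unique : Unique (filterᵇ fmaj≡k (Bn∖Dn n))
  unique = UniqueP.filter⁺ (T? ∘ fmaj≡k) (UniqueP.filter⁺ (T? ∘ not ∘ evenᵇ ∘ neg)
             (UniqueP.filter⁺ (T? ∘ isSignedPermᵇ) (words-unique (alphabet-unique n) n)))
  closed : ∀ {w} → w ∈ filterᵇ fmaj≡k (Bn∖Dn n) → swapOddBlock n w ∈ filterᵇ fmaj≡k (Bn∖Dn n)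
  closed = filterᵇ-closed fmaj≡k (swapOddBlock-∈-Bn∖Dn n)
             (λ {w} w∈ → cong (_≡ᵇ k) (fmaj-swapOddBlock n w (proj₁ (proj₂ (∈-Bn∖Dn⁻ n w∈)))))
  reverses : ∀ {w} → w ∈ filterᵇ fmaj≡k (Bn∖Dn n) → sign (swapOddBlock n w) ≡ ℤ.- sign w
  reverses {w} w∈ with ∈-Bn∖Dn⁻ n (proj₁ (∈-filter⁻ (T? ∘ fmaj≡k) w∈))
  ... | w∈words , sp , odd = sign-swapOddBlock n w even (∈-words⇒All (alphabet n) n w∈words) sp odd

mainTheorem7 : (n : ℕ) → n % 2 ≡ 0 → 2 ≤ n →
    (k : ℕ) → signedFmajPoly (Dn n) k ≡ signedFmajPoly (Bn n) k
mainTheorem7 n even _ k = begin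
  signedFmajPoly (Dn n) k
    ≡⟨ ℤP.+-identityʳ _ ⟨
  signedFmajPoly (Dn n) k ℤ.+ + 0
    ≡⟨ cong (λ s → signedFmajPoly (Dn n) k ℤ.+ s) (signedFmajPoly-Bn∖Dn n even k) ⟨
  signedFmajPoly (Dn n) k ℤ.+ signedFmajPoly (Bn∖Dn n) k
    ≡⟨ sumℤ-filterᵇ-partition sign (λ w → fmaj w ≡ᵇ k) (evenᵇ ∘ neg) (Bn n) ⟨
  signedFmajPoly (Bn n) k
    ∎
  where open ≡-Reasoning
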